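{- Let $\mathcal{F}=(W,\preccurlyeq,V_{\mathcal{F}})$ be a finite poset model and $\mathcal{F}_{\min}=(W_{\min},R_{\min},V_{\min})$ its quotient Kripke model modulo $\equiv_\eta$. Then for each $w\in W$ and each $\mathrm{SLCS}_\eta$ formula $\Phi$: $\mathcal{F},w\models\Phi$ if and only if $\mathcal{F}_{\min},[w]_{\equiv_\eta}\models\Phi$.
   Context: A Kripke model is $(W,R,V)$ with $R\subseteq W\times W$ and $V:PL\to2^W$; a finite poset model is one with $W$ finite and $R=\preccurlyeq$ a partial order. In a Kripke model, a $\pm$-path of length $\ell\ge2$ is $\pi:\{0,\dots,\ell\}\to W$ with $R(\pi(i),\pi(i+1))$ or $R(\pi(i+1),\pi(i))$ for each $i<\ell$, and $R(\pi(0),\pi(1))$, $R(\pi(\ell),\pi(\ell-1))$. $\mathrm{SLCS}_\eta$: $\Phi::=p\mid\neg\Phi\mid\Phi_1\wedge\Phi_2\mid\eta(\Phi_1,\Phi_2)$, with $w\models p$ iff $w\in V(p)$, Boolean connectives standard, $w\models\eta(\Phi_1,\Phi_2)$ iff some $\pm$-path $\pi$ of length $\ell$ with $\pi(0)=w$ has $\pi(\ell)\models\Phi_2$ and $\pi(i)\models\Phi_1$ for all $i<\ell$. In $\mathcal{F}$, $w\equiv_\eta w'$ iff $w,w'$ satisfy the same formulas. $\mathcal{F}_{\min}$: $W_{\min}=W/{\equiv_\eta}$; $R_{\min}([w_1],[w_2])$ iff $w_1'\preccurlyeq w_2'$ for some $w_1'\equiv_\eta w_1$, $w_2'\equiv_\eta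 w_2$; $V_{\min}(p)=\{[w]: w'\in V_{\mathcal{F}}(p)\text{ for some }w'\equiv_\eta w\}$. -}

module Defs where

open import Data.Nat using (ℕ; zero; suc)
open import Data.Fin using (Fin; zero; suc; inject₁; fromℕ)
open import Data.Product using (Σ; ∃; _×_; _,_)
open import Data.Sum using (_⊎_)
open import Relation.Nullary using (¬_)
open import Relation.Binary.PropositionalEquality using (_≡_)
open import Relation.Binary.Structures using (IsPartialOrder)

data Form (PL : Set) : Set where
  atom : PL → Form PL
  neg  : Form PL → Form PL
  conj : Form PL → Form PL → Form PL
  eta  : Form PL → Form PL → Form PL

record Kripke (PL : Set) : Set₁ where
  field
    W : Set
    R : W → W → Set
    V : PL → W → Set

module _ {PL : Set} (M : Kripke PL) where
  open Kripke M

  -- a ±-path of length ℓ = 2 + k (ℓ ≥ 2), indexed by Fin (ℓ + 1)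
  record ±Path (k : ℕ) : Set where
    field
      π     : Fin (suc (suc (suc k))) → W
      step  : (i : Fin (suc (suc k))) →
              R (π (inject₁ i)) (π (suc i)) ⊎ R (π (suc i)) (π (inject₁ i))
      first : R (π zero) (π (suc zero))
      last  : R (π (fromℕ (suc (suc k)))) (π (inject₁ (fromℕ (suc k))))

  _⊨_ : W → Form PL → Set
  w ⊨ atom p     = V p w
  w ⊨ neg Φ      = ¬ (w ⊨ Φ)
  w ⊨ conj Φ Ψ   = (w ⊨ Φ) × (w ⊨ Ψ)
  w ⊨ eta Φ₁ Φ₂  =
    Σ ℕ λ k → Σ (±Path k) λ P →
      (±Path.π P zero ≡ w)
      × (±Path.π P (fromℕ (suc (suc k))) ⊨ Φ₂)
      × ((i : Fin (suc (suc k))) → ±Path.π P (inject₁ i) ⊨ Φ₁)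

  _≡η_ : W → W → Set
  w ≡η w' = (Φ : Form PL) → ((w ⊨ Φ → w' ⊨ Φ) × (w' ⊨ Φ → w ⊨ Φ))

record FinPosetModel (PL : Set) : Set₁ where
  field
    n       : ℕ
    _≼_     : Fin n → Fin n → Set
    isPO    : IsPartialOrder _≡_ _≼_
    V       : PL → Fin n → Set

  kripke : Kripke PL
  kripke = record { W = Fin n ; R = _≼_ ; V = V }

-- q : W → Q presents Q as the quotient W/≡_η (with [w] = q w)
record IsEtaQuotient {PL : Set} (F : FinPosetModel PL) (Q : Set)
         (q : Fin (FinPosetModel.n F) → Q) : Set where
  field
    surj : (c : Q) → ∃ λ w → q w ≡ c
    kernel : (w w' : Fin (FinPosetModel.n F)) →
             (q w ≡ q w' → _≡η_ (FinPosetModel.kripke F) w w')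
             × (_≡η_ (FinPosetModel.kripke F) w w' → q w ≡ q w')

minModel : {PL : Set} (F : FinPosetModel PL) (Q : Set)
           (q : Fin (FinPosetModel.n F) → Q) → Kripke PL
minModel F Q q = record
  { W = Q
  ; R = λ a b → Σ (Fin n) λ w₁ → Σ (Fin n) λ w₂ → (q w₁ ≡ a) × (q w₂ ≡ b) × (w₁ ≼ w₂)
  ; V = λ p a → Σ (Fin n) λ w → (q w ≡ a) × V p w
  }
  where open FinPosetModel F

-- Truth is preserved from F to F_min because q maps ≼ into R_min, so a ±-path of F
-- is sent to a ±-path of F_min.  For the converse, fix a ±-path of F_min witnessing
-- η(Φ₁, Φ₂) and show, from its end backwards, that every representative of each of
-- its points satisfies η(Φ₁, Φ₂) in F: an R_min-step is a ≼-step between some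
-- representatives, reflexivity of ≼ lets a point be prepended to a ±-path whichever
-- way the step goes, and representatives of the same class are ≡η-equivalent.
module Submission where

open import Defs
open import Data.Product using (Σ; _×_; _,_; proj₁)
open import Data.Fin using (Fin; zero; suc; inject₁; fromℕ)
open import Data.Fin.Induction using (>-weakInduction)
open import Data.Nat using (ℕ; suc)
open import Data.Sum using (_⊎_; inj₁; inj₂)
open import Data.Vec.Functional using ([]; _∷_)
open import Relation.Binary.Definitions using (Reflexive)
open import Relation.Binary.Structures using (IsPartialOrder)
open import Relation.Binary.PropositionalEquality using (_≡_; refl; sym; trans)

±Path-map : {PL : Set} (M N : Kripke PL) (f : Kripke.W M → Kripke.W N) →
            (∀ {a b} → Kripke.R M a b → Kripke.R N (f a) (f b)) →
            {k : ℕ} → ±Path M k → ±Path N k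
±Path-map M N f f-mono P = record
  { π     = λ i → f (π i)
  ; step  = λ i → step-map (step i)
  ; first = f-mono first
  ; last  = f-mono last
  }
  where
    open ±Path P
    step-map : ∀ {a b} → Kripke.R M a b ⊎ Kripke.R M b a →
               Kripke.R N (f a) (f b) ⊎ Kripke.R N (f b) (f a)
    step-map (inj₁ r) = inj₁ (f-mono r)
    step-map (inj₂ r) = inj₂ (f-mono r)

module ReflexiveModel {PL : Set} (M : Kripke PL) (R-refl : Reflexive (Kripke.R M)) where
  open Kripke M

  _⊩_ : W → Form PL → Set
  _⊩_ = _⊨_ M

  eta-intro : ∀ Φ₁ Φ₂ {y z} → R z y → y ⊩ Φ₁ → z ⊩ Φ₂ → y ⊩ eta Φ₁ Φ₂
  eta-intro Φ₁ Φ₂ {y} {z} zRy y⊩Φ₁ z⊩Φ₂ = 0 , path , refl , z⊩Φ₂ , y⊩Φ₁-before-end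
    where
      steps : (i : Fin 2) → let π = y ∷ y ∷ z ∷ [] in
              R (π (inject₁ i)) (π (suc i)) ⊎ R (π (suc i)) (π (inject₁ i))
      steps zero       = inj₁ R-refl
      steps (suc zero) = inj₂ zRy
      path : ±Path M 0
      path = record { π = y ∷ y ∷ z ∷ [] ; step = steps ; first = R-refl ; last = zRy }
      y⊩Φ₁-before-end : (i : Fin 2) → ±Path.π path (inject₁ i) ⊩ Φ₁
      y⊩Φ₁-before-end zero       = y⊩Φ₁
      y⊩Φ₁-before-end (suc zero) = y⊩Φ₁

  -- Against a backward step y R x the new path starts with the loop x R x, since a
  -- ±-path must leave its start forwards.
  eta-prepend : ∀ Φ₁ Φ₂ {x y} → x ⊩ Φ₁ → R x y ⊎ R y x → y ⊩ eta Φ₁ Φ₂ → x ⊩ eta Φ₁ Φ₂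
  eta-prepend Φ₁ Φ₂ {x} x⊩Φ₁ (inj₁ xRy) (k , P , refl , end⊩Φ₂ , P⊩Φ₁) =
    suc k , path , refl , end⊩Φ₂ , path⊩Φ₁
    where
      open ±Path P
      steps : (i : Fin (suc (suc (suc k)))) → let π′ = x ∷ π in
              R (π′ (inject₁ i)) (π′ (suc i)) ⊎ R (π′ (suc i)) (π′ (inject₁ i))
      steps zero    = inj₁ xRy
      steps (suc i) = step i
      path : ±Path M (suc k)
      path = record { π = x ∷ π ; step = steps ; first = xRy ; last = last }
      path⊩Φ₁ : (i : Fin (suc (suc (suc k)))) → ±Path.π path (inject₁ i) ⊩ Φ₁
      path⊩Φ₁ zero    = x⊩Φ₁
      path⊩Φ₁ (suc i) = P⊩Φ₁ i
  eta-prepend Φ₁ Φ₂ {x} x⊩Φ₁ (inj₂ yRx) (k , P , refl , end⊩Φ₂ , P⊩Φ₁) =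
    suc (suc k) , path , refl , end⊩Φ₂ , path⊩Φ₁
    where
      open ±Path P
      steps : (i : Fin (suc (suc (suc (suc k))))) → let π′ = x ∷ x ∷ π in
              R (π′ (inject₁ i)) (π′ (suc i)) ⊎ R (π′ (suc i)) (π′ (inject₁ i))
      steps zero          = inj₁ R-refl
      steps (suc zero)    = inj₂ yRx
      steps (suc (suc i)) = step i
      path : ±Path M (suc (suc k))
      path = record { π = x ∷ x ∷ π ; step = steps ; first = R-refl ; last = last }
      path⊩Φ₁ : (i : Fin (suc (suc (suc (suc k))))) → ±Path.π path (inject₁ i) ⊩ Φ₁
      path⊩Φ₁ zero          = x⊩Φ₁
      path⊩Φ₁ (suc zero)    = x⊩Φ₁
      path⊩Φ₁ (suc (suc i)) = P⊩Φ₁ i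

module MinimalModel {PL : Set} (F : FinPosetModel PL) (Q : Set)
                    (q : Fin (FinPosetModel.n F) → Q) (quotient : IsEtaQuotient F Q q) where
  open FinPosetModel F
  open IsEtaQuotient quotient
  open ReflexiveModel kripke (IsPartialOrder.refl isPO) using (_⊩_; eta-intro; eta-prepend)

  _⊨min_ : Q → Form PL → Set
  _⊨min_ = _⊨_ (minModel F Q q)

  R-min : Q → Q → Set
  R-min = Kripke.R (minModel F Q q)

  ⊩-resp-q : ∀ {x y} Φ → q x ≡ q y → x ⊩ Φ → y ⊩ Φ
  ⊩-resp-q Φ qx≡qy = proj₁ (proj₁ (kernel _ _) qx≡qy Φ)

  q-mono : ∀ {a b} → a ≼ b → R-min (q a) (q b)
  q-mono {a} {b} a≼b = a , b , refl , refl , a≼b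

  R-min-step-representatives : ∀ {c d} → R-min c d ⊎ R-min d c →
    Σ (Fin n) λ a → Σ (Fin n) λ b → q a ≡ c × q b ≡ d × (a ≼ b ⊎ b ≼ a)
  R-min-step-representatives (inj₁ (a , b , qa≡c , qb≡d , a≼b)) = a , b , qa≡c , qb≡d , inj₁ a≼b
  R-min-step-representatives (inj₂ (b , a , qb≡d , qa≡c , b≼a)) = a , b , qa≡c , qb≡d , inj₂ b≼a

  Preserved Reflected : Form PL → Set
  Preserved Φ = ∀ x → x ⊩ Φ → q x ⊨min Φ
  Reflected Φ = ∀ x → q x ⊨min Φ → x ⊩ Φ

  reflect-at : ∀ Φ {c x} → Reflected Φ → q x ≡ c → c ⊨min Φ → x ⊩ Φ
  reflect-at Φ reflects refl = reflects _

  eta-preserve : ∀ Φ₁ Φ₂ → Preserved Φ₁ → Preserved Φ₂ → Preserved (eta Φ₁ Φ₂)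
  eta-preserve Φ₁ Φ₂ preserves₁ preserves₂ w (k , P , refl , end⊩Φ₂ , P⊩Φ₁) =
    k , ±Path-map kripke (minModel F Q q) q q-mono P , refl ,
    preserves₂ _ end⊩Φ₂ , λ i → preserves₁ _ (P⊩Φ₁ i)

  eta-reflect : ∀ Φ₁ Φ₂ → Reflected Φ₁ → Reflected Φ₂ → Reflected (eta Φ₁ Φ₂)
  eta-reflect Φ₁ Φ₂ reflects₁ reflects₂ w (k , P , π₀≡qw , end⊨Φ₂ , P⊨Φ₁) =
    >-weakInduction RepresentativesSatisfy at-end backwards zero w (sym π₀≡qw)
    where
      open ±Path P
      RepresentativesSatisfy : Fin (suc (suc k)) → Set
      RepresentativesSatisfy j = ∀ x → q x ≡ π (inject₁ j) → x ⊩ eta Φ₁ Φ₂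

      at-end : RepresentativesSatisfy (fromℕ (suc k))
      at-end x qx≡ with last
      ... | z , y , qz≡ , qy≡ , z≼y =
        ⊩-resp-q (eta Φ₁ Φ₂) (trans qy≡ (sym qx≡))
          (eta-intro Φ₁ Φ₂ z≼y (reflect-at Φ₁ reflects₁ qy≡ (P⊨Φ₁ (fromℕ (suc k))))
                           (reflect-at Φ₂ reflects₂ qz≡ end⊨Φ₂))

      backwards : (j : Fin (suc k)) → RepresentativesSatisfy (suc j) → RepresentativesSatisfy (inject₁ j)
      backwards j next x qx≡ with R-min-step-representatives (step (inject₁ j))
      ... | a , b , qa≡ , qb≡ , a~b =
        ⊩-resp-q (eta Φ₁ Φ₂) (trans qa≡ (sym qx≡))
          (eta-prepend Φ₁ Φ₂ (reflect-at Φ₁ reflects₁ qa≡ (P⊨Φ₁ (inject₁ j))) a~b (next b qb≡))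

  truth-preserved : ∀ Φ → Preserved Φ
  truth-reflected : ∀ Φ → Reflected Φ

  truth-preserved (atom p)      w w⊩p         = w , refl , w⊩p
  truth-preserved (neg Φ)       w w⊮Φ qw⊨Φ    = w⊮Φ (truth-reflected Φ w qw⊨Φ)
  truth-preserved (conj Φ Ψ)    w (w⊩Φ , w⊩Ψ) = truth-preserved Φ w w⊩Φ , truth-preserved Ψ w w⊩Ψ
  truth-preserved (eta Φ₁ Φ₂)                 = eta-preserve Φ₁ Φ₂ (truth-preserved Φ₁) (truth-preserved Φ₂)

  truth-reflected (atom p)      w (w′ , qw′≡qw , w′⊩p) = ⊩-resp-q (atom p) qw′≡qw w′⊩p
  truth-reflected (neg Φ)       w qw⊭Φ w⊩Φ            = qw⊭Φ (truth-preserved Φ w w⊩Φ)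
  truth-reflected (conj Φ Ψ)    w (qw⊨Φ , qw⊨Ψ)       = truth-reflected Φ w qw⊨Φ , truth-reflected Ψ w qw⊨Ψ
  truth-reflected (eta Φ₁ Φ₂)                         = eta-reflect Φ₁ Φ₂ (truth-reflected Φ₁) (truth-reflected Φ₂)

theorem5p11 : {PL : Set} (F : FinPosetModel PL) (Q : Set)
              (q : Fin (FinPosetModel.n F) → Q) → IsEtaQuotient F Q q →
              (w : Fin (FinPosetModel.n F)) (Φ : Form PL) →
              ((_⊨_ (FinPosetModel.kripke F) w Φ → _⊨_ (minModel F Q q) (q w) Φ)
               × (_⊨_ (minModel F Q q) (q w) Φ → _⊨_ (FinPosetModel.kripke F) w Φ))
theorem5p11 F Q q quotient w Φ = truth-preserved Φ w , truth-reflected Φ w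
  where open MinimalModel F Q q quotient
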